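{- For all natural numbers $n,k,j$ with $0\leq k\leq j\leq n$ and every bijection $b:\{0,\ldots,n\}\to\{0,\ldots,n\}$, the clause $c'_b(k,j)$ is derivable by resolution from $C(n)$.
   Context: Work in a first-order language with a constant $0$, unary function symbols $s$ and $f$, a binary function symbol $\max$, a binary predicate symbol $\leq$, and atoms of the form $f(t)=k$ where $t$ is a term and $k$ is a numeral; here $=$ is an uninterpreted binary predicate (no equality axioms). A clause is a sequent $\Pi \vdash \Delta$ of finite multisets of atoms; its variables are implicitly universally quantified. For $n\ge 0$, $C(n)$ consists of, with variables $\alpha,\beta,\gamma$: (C1) $\vdash \alpha \leq \alpha$; (C2) $\max(\alpha,\beta)\leq\gamma \vdash \alpha\leq\gamma$; (C3) $\max(\alpha,\beta)\leq\gamma \vdash \beta\leq\gamma$; (C4$(k)$) $f(\beta)=k,\ f(\alpha)=k,\ s(\beta)\leq\alpha \vdash$ for each $0\le k\le n$; (C5) $\vdash f(\alpha)=0,\ldots, f(\alpha)=n$. A clause is derivable by resolution from $C(n)$ if it is obtained in finitely many steps from variable-renamed copies of clauses of $C(n)$ by the resolution rule (from $\Pi\vdash P,\Delta$ and $\Pi',P'\vdash\Delta'$ and a substitution $\sigma$ with $P\sigma=P'\sigma$, infer $\Pi\sigma,\Pi'\sigma\vdash\Delta\sigma,\Delta'\sigma$) and contraction (merging identical atoms on one side). Let $x_1,x_2,\ldots$ be variables and, for $k\ge 0$, let $T_k=m(k,x,s(x_{k+1}))=\max(s(x_1),\max(s(x_2),\ldots,\max(s(x_k),s(x_{k+1}))\ldots))$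 (so $T_0=s(x_1)$), where $m(0,x,t)=t$ and $m(k+1,x,t)=m(k,x,\max(s(x_{k+1}),t))$. For $0\le k\le j\le n$ and a bijection $b$ of $\{0,\ldots,n\}$, $c'_b(k,j)$ is the clause $f(x_1)=b(0),\ f(x_2)=b(1),\ \ldots,\ f(x_{k+1})=b(k)\ \vdash\ f(T_k)=b(k+1),\ \ldots,\ f(T_k)=b(j)$ (the succedent is empty when $j=k$). -}

module Defs where

open import Data.Nat using (ℕ; zero; suc; _<?_)
open import Data.Fin using (Fin; toℕ; fromℕ<)
open import Data.List using (List; []; _∷_; map; _++_; upTo; drop)
open import Data.Product using (_×_; _,_)
open import Data.List.Relation.Binary.Permutation.Propositional using (_↭_)
open import Relation.Binary.PropositionalEquality using (_≡_)
open import Relation.Nullary using (yes; no)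
open import Function.Definitions using (Injective)

data Term : Set where
  var  : ℕ → Term
  zer  : Term
  s    : Term → Term
  f    : Term → Term
  max  : Term → Term → Term

data Atom : Set where
  _≤'_ : Term → Term → Atom
  feq  : Term → ℕ → Atom          -- feq t k  is the atom  f(t) = k

-- A clause Π ⊢ Δ; lists, taken up to permutation (see rule `perm`) = multisets.
Clause : Set
Clause = List Atom × List Atom

Subst : Set
Subst = ℕ → Term

substT : Subst → Term → Term
substT σ (var i)   = σ i
substT σ zer       = zer
substT σ (s t)     = s (substT σ t)
substT σ (f t)     = f (substT σ t)
substT σ (max t u) = max (substT σ t) (substT σ u)

substA : Subst → Atom → Atom
substA σ (t ≤' u)  = substT σ t ≤' substT σ u
substA σ (feq t k) = feq (substT σ t) k

substC : Subst → Clause → Clause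
substC σ (Π , Δ) = map (substA σ) Π , map (substA σ) Δ

α β γ : Term
α = var 0
β = var 1
γ = var 2

data InC (n : ℕ) : Clause → Set where
  C1 : InC n ([] , (α ≤' α) ∷ [])
  C2 : InC n ((max α β ≤' γ) ∷ [] , (α ≤' γ) ∷ [])
  C3 : InC n ((max α β ≤' γ) ∷ [] , (β ≤' γ) ∷ [])
  C4 : (k : ℕ) → k Data.Nat.≤ n →
       InC n (feq β k ∷ feq α k ∷ (s β ≤' α) ∷ [] , [])
  C5 : InC n ([] , map (feq α) (upTo (suc n)))

data Derivable (n : ℕ) : Clause → Set where
  axiom : ∀ {c} → InC n c → (ρ : ℕ → ℕ) → Injective _≡_ _≡_ ρ →
          Derivable n (substC (λ i → var (ρ i)) c)
  resolve : ∀ {Π Δ Π' Δ' P P'} (σ : Subst) →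
            Derivable n (Π , P ∷ Δ) → Derivable n (P' ∷ Π' , Δ') →
            substA σ P ≡ substA σ P' →
            Derivable n (map (substA σ) Π ++ map (substA σ) Π' ,
                         map (substA σ) Δ ++ map (substA σ) Δ')
  contrL : ∀ {P Π Δ} → Derivable n (P ∷ P ∷ Π , Δ) → Derivable n (P ∷ Π , Δ)
  contrR : ∀ {P Π Δ} → Derivable n (Π , P ∷ P ∷ Δ) → Derivable n (Π , P ∷ Δ)
  perm   : ∀ {Π Π' Δ Δ'} → Π ↭ Π' → Δ ↭ Δ' →
           Derivable n (Π , Δ) → Derivable n (Π' , Δ')

x : ℕ → Term
x i = var i

m : ℕ → Term → Term
m zero    t = t
m (suc k) t = m k (max (s (x (suc k))) t)

T : ℕ → Term
T k = m k (s (x (suc k)))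

-- Extend b : Fin (suc n) → Fin (suc n) to ℕ (value outside range irrelevant).
ext : {n : ℕ} → (Fin (suc n) → Fin (suc n)) → ℕ → ℕ
ext {n} b i with i <? suc n
... | yes p = toℕ (b (fromℕ< p))
... | no _  = 0

c' : {n : ℕ} → (Fin (suc n) → Fin (suc n)) → ℕ → ℕ → Clause
c' b k j = map (λ i → feq (x (suc i)) (ext b i)) (upTo (suc k)) ,
           map (λ i → feq (T k) (ext b i)) (drop (suc k) (upTo (suc j)))

-- Derivations are first built in an auxiliary calculus whose leaves are arbitrary instances of
-- clauses of C(n) and whose resolution steps cut syntactically equal atoms.  Renaming the two
-- premises of a resolution apart (to odd and even variables) and interleaving their instantiating
-- substitutions lifts such a derivation to a resolution derivation proper.
--
-- In that calculus  f(t₁)=v₁, …, f(t_r)=v_r ⊢ f(M)=w₁, …, f(M)=w_q  is derivable whenever every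
-- s(tᵢ) ≤ M follows from C1–C3 and the values v, w, together with further values u₁, …, u_p,
-- enumerate 0, …, n; induction on (q + p, p).  If p = 0, resolve the C5 instance
-- ⊢ f(M)=0, …, f(M)=n against C4(vᵢ) at M, tᵢ to remove every f(M)=vᵢ.  Otherwise resolve the
-- clause with f(M)=u₁ added to its succedent against the refutation of f(M)=u₁, f(t₁)=v₁, …
-- (the case r + 1, q = 0, with M' = max(s M, M)) and contract.  c'_b(k,j) is the case tᵢ = xᵢ,
-- M = T_k.

module Submission where

open import Defs
open import Data.Nat using (ℕ; zero; suc; _≤_; _<_; _<?_; z≤n; s≤s; s≤s⁻¹)
open import Data.Nat.Properties using (suc-injective; 1+n≢0; m≤n⇒m<n∨m≡n; m<1+n⇒m<n∨m≡n)
open import Data.Fin using (Fin; toℕ)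
open import Data.Fin.Properties using (toℕ<n; fromℕ<-toℕ)
open import Data.List using (List; []; _∷_; map; _++_; upTo; applyUpTo; drop; length; tabulate; allFin)
open import Data.List.Properties
  using (map-∘; map-cong; map-id; map-++; map-upTo; map-tabulate; tabulate-cong; ++-assoc; ++-identityʳ)
open import Data.List.Membership.Propositional using (_∈_)
open import Data.List.Membership.Propositional.Properties
  using (∈-map⁻; ∈-++⁺ˡ; ∈-++⁺ʳ; ∈-∃++; ∈-upTo⁻; ∈-allFin; ∈-tabulate⁺)
open import Data.List.Membership.Propositional.Properties.WithK using (unique∧set⇒bag)
open import Data.List.Relation.Unary.Any using (here; there)
open import Data.List.Relation.Unary.Unique.Propositional.Properties using (tabulate⁺; allFin⁺)
open import Data.List.Relation.Binary.BagAndSetEquality using (∼bag⇒↭)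
open import Data.List.Relation.Binary.Permutation.Propositional
  using (_↭_; ↭-refl; ↭-sym; ↭-trans; ↭-reflexive; ↭-prep; module PermutationReasoning)
open import Data.List.Relation.Binary.Permutation.Propositional.Properties
  using (map⁺; ↭-map-inv; ↭-length; ++⁺ˡ; shift; ↭-reverse; ∈-resp-↭)
open import Data.Product using (_×_; _,_; proj₂; uncurry)
open import Data.Empty using (⊥-elim)
open import Data.Sum using (inj₁; inj₂)
open import Function using (_∘_; id; Injective; mk⇔; _⤖_; Bijection)
open import Relation.Binary.PropositionalEquality
open import Relation.Nullary using (yes; no)

ren : (ℕ → ℕ) → Subst
ren ρ i = var (ρ i)

_⊙_ : Subst → Subst → Subst
(σ ⊙ θ) i = substT σ (θ i)

substT-⊙ : ∀ σ θ t → substT σ (substT θ t) ≡ substT (σ ⊙ θ) t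
substT-⊙ σ θ (var i)   = refl
substT-⊙ σ θ zer       = refl
substT-⊙ σ θ (s t)     = cong s (substT-⊙ σ θ t)
substT-⊙ σ θ (f t)     = cong f (substT-⊙ σ θ t)
substT-⊙ σ θ (max t u) = cong₂ max (substT-⊙ σ θ t) (substT-⊙ σ θ u)

substT-cong : ∀ {σ σ′} → σ ≗ σ′ → substT σ ≗ substT σ′
substT-cong σ≗σ′ (var i)   = σ≗σ′ i
substT-cong σ≗σ′ zer       = refl
substT-cong σ≗σ′ (s t)     = cong s (substT-cong σ≗σ′ t)
substT-cong σ≗σ′ (f t)     = cong f (substT-cong σ≗σ′ t)
substT-cong σ≗σ′ (max t u) = cong₂ max (substT-cong σ≗σ′ t) (substT-cong σ≗σ′ u)

substT-var : substT var ≗ id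
substT-var (var i)   = refl
substT-var zer       = refl
substT-var (s t)     = cong s (substT-var t)
substT-var (f t)     = cong f (substT-var t)
substT-var (max t u) = cong₂ max (substT-var t) (substT-var u)

substA-⊙ : ∀ σ θ a → substA σ (substA θ a) ≡ substA (σ ⊙ θ) a
substA-⊙ σ θ (t ≤' u)  = cong₂ _≤'_ (substT-⊙ σ θ t) (substT-⊙ σ θ u)
substA-⊙ σ θ (feq t k) = cong (λ t′ → feq t′ k) (substT-⊙ σ θ t)

substA-cong : ∀ {σ σ′} → σ ≗ σ′ → substA σ ≗ substA σ′
substA-cong σ≗σ′ (t ≤' u)  = cong₂ _≤'_ (substT-cong σ≗σ′ t) (substT-cong σ≗σ′ u)
substA-cong σ≗σ′ (feq t k) = cong (λ t′ → feq t′ k) (substT-cong σ≗σ′ t)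

substA-var : substA var ≗ id
substA-var (t ≤' u)  = cong₂ _≤'_ (substT-var t) (substT-var u)
substA-var (feq t k) = cong (λ t′ → feq t′ k) (substT-var t)

substC-var : ∀ c → substC var c ≡ c
substC-var (Π , Δ) = cong₂ _,_ (map-var Π) (map-var Δ)
  where
  map-var : ∀ L → map (substA var) L ≡ L
  map-var L = trans (map-cong substA-var L) (map-id L)

substA-rename : ∀ {σ ρ τ θ} → σ ⊙ ren ρ ≗ τ ⊙ θ → substA σ ∘ substA (ren ρ) ≗ substA τ ∘ substA θ
substA-rename {σ} {ρ} {τ} {θ} eq a =
  trans (substA-⊙ σ (ren ρ) a) (trans (substA-cong eq a) (sym (substA-⊙ τ θ a)))

map-substA-rename : ∀ {σ ρ τ θ} → σ ⊙ ren ρ ≗ τ ⊙ θ →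
  map (substA σ) ∘ map (substA (ren ρ)) ≗ map (substA τ) ∘ map (substA θ)
map-substA-rename eq L = trans (sym (map-∘ L)) (trans (map-cong (substA-rename eq) L) (map-∘ L))

even odd : ℕ → ℕ
even zero    = zero
even (suc i) = suc (suc (even i))
odd i = suc (even i)

even-injective : Injective _≡_ _≡_ even
even-injective {zero}  {zero}  _  = refl
even-injective {suc i} {suc j} eq = cong suc (even-injective (suc-injective (suc-injective eq)))

odd-injective : Injective _≡_ _≡_ odd
odd-injective = even-injective ∘ suc-injective

interleave : Subst → Subst → Subst
interleave σ θ zero          = σ zero
interleave σ θ (suc zero)    = θ zero
interleave σ θ (suc (suc i)) = interleave (σ ∘ suc) (θ ∘ suc) i

interleave-even : ∀ σ θ i → interleave σ θ (even i) ≡ σ i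
interleave-even σ θ zero    = refl
interleave-even σ θ (suc i) = interleave-even (σ ∘ suc) (θ ∘ suc) i

interleave-odd : ∀ σ θ i → interleave σ θ (odd i) ≡ θ i
interleave-odd σ θ zero    = refl
interleave-odd σ θ (suc i) = interleave-odd (σ ∘ suc) (θ ∘ suc) i

assign : Term → Term → Term → Subst
assign a b c zero          = a
assign a b c (suc zero)    = b
assign a b c (suc (suc _)) = c

module _ (n : ℕ) where

  mutual
    data Der : Clause → Set where
      leaf : ∀ {A B Π Δ} → InC n (A , B) → (τ : Subst) →
             Π ↭ map (substA τ) A → Δ ↭ map (substA τ) B → Der (Π , Δ)
      node : ∀ {c} → Der⁺ c → Der c

    -- An instance of a clause of C(n) is not itself derivable, so only derivations ending in an
    -- inference (Der⁺) lift; hence contraction and permutation never act on a bare leaf.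
    data Der⁺ : Clause → Set where
      resolve⁺ : ∀ {Π Δ Π′ Δ′ P} → Der (Π , P ∷ Δ) → Der (P ∷ Π′ , Δ′) → Der⁺ (Π ++ Π′ , Δ ++ Δ′)
      contrL⁺  : ∀ {P Π Δ} → Der⁺ (P ∷ P ∷ Π , Δ) → Der⁺ (P ∷ Π , Δ)
      perm⁺    : ∀ {Π Π′ Δ Δ′} → Π ↭ Π′ → Δ ↭ Δ′ → Der⁺ (Π , Δ) → Der⁺ (Π′ , Δ′)

  Renamings : Clause → Set
  Renamings D = ∀ ρ → Injective _≡_ _≡_ ρ → Derivable n (substC (ren ρ) D)

  Instances : Clause → Set
  Instances c = ∀ τ → Derivable n (substC τ c)

  record Lift (c : Clause) : Set where
    constructor lift
    field
      {general} : Clause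
      renamings : Renamings general
      instantiation : Subst
      is-instance : c ≡ substC instantiation general

  instances⇒lift : ∀ {c} → Instances c → Lift c
  instances⇒lift {c} inst = lift (λ ρ _ → inst (ren ρ)) var (sym (substC-var c))

  resolve-apart : ∀ {A₁ B₁ A₂ B₂ Q₁ Q₂} τ₁ τ₂ →
    Renamings (A₁ , Q₁ ∷ B₁) → Renamings (Q₂ ∷ A₂ , B₂) → substA τ₁ Q₁ ≡ substA τ₂ Q₂ →
    Instances (map (substA τ₁) A₁ ++ map (substA τ₂) A₂ , map (substA τ₁) B₁ ++ map (substA τ₂) B₂)
  resolve-apart {A₁} {B₁} {A₂} {B₂} {Q₁} {Q₂} τ₁ τ₂ r₁ r₂ Q₁~Q₂ τ =
    subst (Derivable n) (cong₂ _,_ (merge A₁ A₂) (merge B₁ B₂))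
      (resolve σ (r₁ odd odd-injective) (r₂ even even-injective) unifies)
    where
    σ : Subst
    σ = interleave (τ ⊙ τ₂) (τ ⊙ τ₁)
    apart₁ : σ ⊙ ren odd ≗ τ ⊙ τ₁
    apart₁ = interleave-odd _ _
    apart₂ : σ ⊙ ren even ≗ τ ⊙ τ₂
    apart₂ = interleave-even _ _
    unifies : substA σ (substA (ren odd) Q₁) ≡ substA σ (substA (ren even) Q₂)
    unifies = trans (substA-rename apart₁ Q₁)
                (trans (cong (substA τ) Q₁~Q₂) (sym (substA-rename apart₂ Q₂)))
    merge : ∀ L₁ L₂ →
      map (substA σ) (map (substA (ren odd)) L₁) ++ map (substA σ) (map (substA (ren even)) L₂)
        ≡ map (substA τ) (map (substA τ₁) L₁ ++ map (substA τ₂) L₂)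
    merge L₁ L₂ =
      trans (cong₂ _++_ (map-substA-rename {θ = τ₁} apart₁ L₁) (map-substA-rename {θ = τ₂} apart₂ L₂))
            (sym (map-++ (substA τ) (map (substA τ₁) L₁) (map (substA τ₂) L₂)))

  lift-resolve : ∀ {Π Δ Π′ Δ′ P P′} →
    Lift (Π , P ∷ Δ) → Lift (P′ ∷ Π′ , Δ′) → P ≡ P′ → Instances (Π ++ Π′ , Δ ++ Δ′)
  lift-resolve (lift {_ , _ ∷ _} r₁ τ₁ refl) (lift {_ ∷ _ , _} r₂ τ₂ refl) = resolve-apart τ₁ τ₂ r₁ r₂

  mutual
    lift-Der : ∀ {c} → Der c → Lift c
    lift-Der (leaf {A} {B} c∈C τ Π↭ Δ↭)
      with A′ , refl , A↭A′ ← ↭-map-inv (substA τ) (↭-sym Π↭)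
         | B′ , refl , B↭B′ ← ↭-map-inv (substA τ) (↭-sym Δ↭) =
      lift (λ ρ ρ-inj → perm (map⁺ _ A↭A′) (map⁺ _ B↭B′) (axiom c∈C ρ ρ-inj)) τ refl
    lift-Der (node d) = instances⇒lift (instances-Der⁺ d)

    instances-Der⁺ : ∀ {c} → Der⁺ c → Instances c
    instances-Der⁺ (resolve⁺ d₁ d₂)  = lift-resolve (lift-Der d₁) (lift-Der d₂) refl
    instances-Der⁺ (contrL⁺ d) τ     = contrL (instances-Der⁺ d τ)
    instances-Der⁺ (perm⁺ p q d) τ   = perm (map⁺ _ p) (map⁺ _ q) (instances-Der⁺ d τ)

  Der⁺⇒Derivable : ∀ {c} → Der⁺ c → Derivable n c
  Der⁺⇒Derivable {c} d = subst (Derivable n) (substC-var c) (instances-Der⁺ d var)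

module _ (n : ℕ) where

  -- Phrased through arbitrary upper bounds W since C(n) has no transitivity clause.
  Below : Term → Term → Set
  Below a M = ∀ {W} → Der n ([] , (M ≤' W) ∷ []) → Der n ([] , (a ≤' W) ∷ [])

  below-trans : ∀ {a b c} → Below a b → Below b c → Below a c
  below-trans a<b b<c d = a<b (b<c d)

  below-maxˡ : ∀ {a b} → Below a (max a b)
  below-maxˡ {a} {b} {W} d = node (resolve⁺ d (leaf C2 (assign a b W) ↭-refl ↭-refl))

  below-maxʳ : ∀ {a b} → Below b (max a b)
  below-maxʳ {a} {b} {W} d = node (resolve⁺ d (leaf C3 (assign a b W) ↭-refl ↭-refl))

  below⇒≤ : ∀ {a M} → Below a M → Der n ([] , (a ≤' M) ∷ [])
  below⇒≤ {M = M} a<M = a<M (leaf C1 (assign M M M) ↭-refl ↭-refl)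

  below-m-acc : ∀ k t → Below t (m k t)
  below-m-acc zero    t d = d
  below-m-acc (suc k) t   = below-trans below-maxʳ (below-m-acc k _)

  below-m : ∀ k t {i} → i < k → Below (s (x (suc i))) (m k t)
  below-m (suc k) t i<1+k with m<1+n⇒m<n∨m≡n i<1+k
  ... | inj₁ i<k  = below-m k _ i<k
  ... | inj₂ refl = below-trans below-maxˡ (below-m-acc k _)

  below-T : ∀ k {i} → i ≤ k → Below (s (x (suc i))) (T k)
  below-T k i≤k with m≤n⇒m<n∨m≡n i≤k
  ... | inj₁ i<k  = below-m k _ i<k
  ... | inj₂ refl = below-m-acc k _

  refute : ∀ {t M v} → v ≤ n → Below (s t) M → Der⁺ n (feq M v ∷ feq t v ∷ [] , [])
  refute {t} {M} {v} v≤n t<M =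
    resolve⁺ (below⇒≤ t<M) (leaf (C4 v v≤n) (assign M t M) (↭-reverse _) ↭-refl)

  cut : ∀ {Γ Δ t M v} → v ≤ n → Below (s t) M → Der n (Γ , feq M v ∷ Δ) → Der⁺ n (Γ ++ feq t v ∷ [] , Δ)
  cut {Δ = Δ} v≤n t<M d =
    perm⁺ ↭-refl (↭-reflexive (++-identityʳ Δ)) (resolve⁺ d (node (refute v≤n t<M)))

  fAtoms : List (Term × ℕ) → List Atom
  fAtoms = map (uncurry feq)

  cut-all : ∀ {Γ Δ M} p ps →
    (∀ {v} → v ∈ map proj₂ (p ∷ ps) → v ≤ n) → (∀ {t v} → (t , v) ∈ p ∷ ps → Below (s t) M) →
    Der n (Γ , map (feq M) (map proj₂ (p ∷ ps)) ++ Δ) → Der⁺ n (Γ ++ fAtoms (p ∷ ps) , Δ)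
  cut-all (t , v) []       bounded below d = cut (bounded (here refl)) (below (here refl)) d
  cut-all {Γ} (t , v) (p ∷ ps) bounded below d =
    perm⁺ (↭-reflexive (++-assoc Γ _ _)) ↭-refl
      (cut-all p ps (bounded ∘ there) (below ∘ there)
        (node (cut (bounded (here refl)) (below (here refl)) d)))

  contract : ∀ {a Π Δ} → a ∈ Π → Der⁺ n (a ∷ Π , Δ) → Der⁺ n (Π , Δ)
  contract {a} a∈Π d with Π₁ , Π₂ , refl ← ∈-∃++ a∈Π =
    perm⁺ (↭-sym (shift a Π₁ Π₂)) ↭-refl (contrL⁺ (perm⁺ (↭-prep a (shift a Π₁ Π₂)) ↭-refl d))

  contract-⊆ : ∀ {Γ Π Δ} → (∀ {a} → a ∈ Γ → a ∈ Π) → Der⁺ n (Γ ++ Π , Δ) → Der⁺ n (Π , Δ)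
  contract-⊆ {[]}    _    d = d
  contract-⊆ {a ∷ Γ} Γ⊆Π d = contract-⊆ (Γ⊆Π ∘ there) (contract (∈-++⁺ʳ Γ (Γ⊆Π (here refl))) d)

  -- ℓ = length (ws ++ us) is a measure: the recursion is lexicographic in (ℓ, us).
  derive-clause : ∀ ℓ M p ps ws us → (∀ {t v} → (t , v) ∈ p ∷ ps → Below (s t) M) →
    length (ws ++ us) ≡ ℓ → map proj₂ (p ∷ ps) ++ ws ++ us ↭ upTo (suc n) →
    Der⁺ n (fAtoms (p ∷ ps) , map (feq M) ws)
  derive-clause ℓ M p ps ws [] below _ H = cut-all p ps bounded below (leaf C5 (assign M M M) ↭-refl C5↭)
    where
    open PermutationReasoning
    vs : List ℕ
    vs = map proj₂ (p ∷ ps)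
    bounded : ∀ {v} → v ∈ vs → v ≤ n
    bounded v∈vs = s≤s⁻¹ (∈-upTo⁻ (∈-resp-↭ H (∈-++⁺ˡ v∈vs)))
    C5↭ : map (feq M) vs ++ map (feq M) ws ↭ map (substA (assign M M M)) (map (feq α) (upTo (suc n)))
    C5↭ = begin
      map (feq M) vs ++ map (feq M) ws ≡⟨ map-++ (feq M) vs ws ⟨
      map (feq M) (vs ++ ws)           ≡⟨ cong (map (feq M) ∘ (vs ++_)) (++-identityʳ ws) ⟨
      map (feq M) (vs ++ ws ++ [])     ↭⟨ map⁺ (feq M) H ⟩
      map (feq M) (upTo (suc n))       ≡⟨ map-∘ (upTo (suc n)) ⟩
      map (substA (assign M M M)) (map (feq α) (upTo (suc n))) ∎
  derive-clause zero M p ps ws (u ∷ us) _ len _ =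
    ⊥-elim (1+n≢0 (trans (↭-length (↭-sym (shift u ws us))) len))
  derive-clause (suc ℓ) M p ps ws (u ∷ us) below len H =
    perm⁺ ↭-refl (↭-reflexive (++-identityʳ _)) (contract-⊆ id (resolve⁺
      (node (derive-clause (suc ℓ) M p ps (u ∷ ws) us below len′ H′))
      (node (derive-clause ℓ (max (s M) M) (M , u) (p ∷ ps) [] (ws ++ us) below′
               (suc-injective len′) H″))))
    where
    len′ : length (u ∷ ws ++ us) ≡ suc ℓ
    len′ = trans (↭-length (↭-sym (shift u ws us))) len
    H′ : map proj₂ (p ∷ ps) ++ u ∷ ws ++ us ↭ upTo (suc n)
    H′ = ↭-trans (++⁺ˡ (map proj₂ (p ∷ ps)) (↭-sym (shift u ws us))) H
    H″ : u ∷ map proj₂ (p ∷ ps) ++ ws ++ us ↭ upTo (suc n)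
    H″ = ↭-trans (↭-sym (shift u (map proj₂ (p ∷ ps)) (ws ++ us))) H′
    below′ : ∀ {t v} → (t , v) ∈ (M , u) ∷ p ∷ ps → Below (s t) (max (s M) M)
    below′ (here refl) = below-maxˡ
    below′ (there tv∈) = below-trans (below tv∈) below-maxʳ

map-upTo-segments : ∀ {A : Set} (g : ℕ → A) {k j l} → k ≤ j → j ≤ l →
  map g (upTo k) ++ map g (drop k (upTo j)) ++ map g (drop j (upTo l)) ≡ map g (upTo l)
map-upTo-segments g {k} {j} {l} k≤j j≤l = begin
  map g L₁ ++ map g L₂ ++ map g L₃ ≡⟨ cong (map g L₁ ++_) (map-++ g L₂ L₃) ⟨
  map g L₁ ++ map g (L₂ ++ L₃)     ≡⟨ map-++ g L₁ (L₂ ++ L₃) ⟨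
  map g (L₁ ++ L₂ ++ L₃)           ≡⟨ cong (map g) segments ⟩
  map g (upTo l)                   ∎
  where
  open ≡-Reasoning
  L₁ L₂ L₃ : List ℕ
  L₁ = upTo k
  L₂ = drop k (upTo j)
  L₃ = drop j (upTo l)
  applyUpTo-++-drop : ∀ {B : Set} (h : ℕ → B) {a b} → a ≤ b →
    applyUpTo h a ++ drop a (applyUpTo h b) ≡ applyUpTo h b
  applyUpTo-++-drop h z≤n       = refl
  applyUpTo-++-drop h (s≤s a≤b) = cong (h zero ∷_) (applyUpTo-++-drop (h ∘ suc) a≤b)
  segments : L₁ ++ L₂ ++ L₃ ≡ upTo l
  segments = trans (sym (++-assoc L₁ L₂ L₃))
               (trans (cong (_++ L₃) (applyUpTo-++-drop id k≤j)) (applyUpTo-++-drop id j≤l))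

applyUpTo≡tabulate : ∀ {A : Set} (g : ℕ → A) l → applyUpTo g l ≡ tabulate {n = l} (g ∘ toℕ)
applyUpTo≡tabulate g zero    = refl
applyUpTo≡tabulate g (suc l) = cong (g zero ∷_) (applyUpTo≡tabulate (g ∘ suc) l)

ext-toℕ : ∀ {n} (π : Fin (suc n) → Fin (suc n)) → ext π ∘ toℕ ≗ toℕ ∘ π
ext-toℕ {n} π i with toℕ i <? suc n
... | yes i<1+n = cong (toℕ ∘ π) (fromℕ<-toℕ i i<1+n)
... | no  i≮1+n = ⊥-elim (i≮1+n (toℕ<n i))

tabulate-bijection-↭ : ∀ {l} (b : Fin l ⤖ Fin l) → tabulate (Bijection.to b) ↭ allFin l
tabulate-bijection-↭ {l} b =
  ∼bag⇒↭ (unique∧set⇒bag (tabulate⁺ injective) (allFin⁺ l) (mk⇔ (λ _ → ∈-allFin _) onto))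
  where
  open Bijection b using (to; injective; strictlySurjective)
  onto : ∀ {y} → y ∈ allFin l → y ∈ tabulate to
  onto {y} _ with i , refl ← strictlySurjective y = ∈-tabulate⁺ i

ext-upTo-↭ : ∀ {n} (b : Fin (suc n) ⤖ Fin (suc n)) →
  map (ext (Bijection.to b)) (upTo (suc n)) ↭ upTo (suc n)
ext-upTo-↭ {n} b = begin
  map (ext to) (upTo (suc n)) ≡⟨ map-upTo (ext to) (suc n) ⟩
  applyUpTo (ext to) (suc n)  ≡⟨ applyUpTo≡tabulate (ext to) (suc n) ⟩
  tabulate (ext to ∘ toℕ)     ≡⟨ tabulate-cong (ext-toℕ to) ⟩
  tabulate (toℕ ∘ to)         ≡⟨ map-tabulate to toℕ ⟨
  map toℕ (tabulate to)       ↭⟨ map⁺ toℕ (tabulate-bijection-↭ b) ⟩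
  map toℕ (allFin (suc n))    ≡⟨ map-tabulate id toℕ ⟩
  tabulate toℕ                ≡⟨ applyUpTo≡tabulate id (suc n) ⟨
  upTo (suc n)                ∎
  where
  open PermutationReasoning
  open Bijection b using (to)

lemma7 : (n k j : ℕ) → k ≤ j → j ≤ n → (b : Fin (suc n) ⤖ Fin (suc n)) →
    Derivable n (c' (Bijection.to b) k j)
lemma7 n k j k≤j j≤n b =
  subst (Derivable n)
    (cong₂ _,_ (sym (map-∘ (upTo (suc k)))) (sym (map-∘ (drop (suc k) (upTo (suc j))))))
    -- pair 0 ∷ map pair (applyUpTo suc k) computes to map pair (upTo (suc k)).
    (Der⁺⇒Derivable n (derive-clause n _ (T k) (pair 0) (map pair (applyUpTo suc k)) ws us below refl H))
  where
  e : ℕ → ℕ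
  e = ext (Bijection.to b)
  pair : ℕ → Term × ℕ
  pair i = x (suc i) , e i
  ws us : List ℕ
  ws = map e (drop (suc k) (upTo (suc j)))
  us = map e (drop (suc j) (upTo (suc n)))
  below : ∀ {t v} → (t , v) ∈ map pair (upTo (suc k)) → Below n (s t) (T k)
  below tv∈ with i , i∈ , refl ← ∈-map⁻ pair tv∈ = below-T n k (s≤s⁻¹ (∈-upTo⁻ i∈))
  H : map proj₂ (map pair (upTo (suc k))) ++ ws ++ us ↭ upTo (suc n)
  H = ↭-trans (↭-reflexive (trans (cong (_++ ws ++ us) (sym (map-∘ (upTo (suc k)))))
                                  (map-upTo-segments e (s≤s k≤j) (s≤s j≤n))))
              (ext-upTo-↭ b)
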